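{- Let $n\geq 1$, let $U_{6n}=\langle a,b\mid a^{2n}=b^3=1,\ a^{ -1}ba=b^{ -1}\rangle$, and let $\Gamma=\Gamma(U_{6n})$ be its non-commuting graph. Then the independent polynomial of $\Gamma$ is $$I(\Gamma;x)=1+\sum_{k=1}^{n}\left(\binom{2n}{k}+3\binom{n}{k}\right)x^k+\sum_{k=n+1}^{2n}\binom{2n}{k}x^k.$$
   Context: The group $U_{6n}$ has order $6n$ and center $Z(U_{6n})=\langle a^2\rangle$. For a finite group $G$, the non-commuting graph $\Gamma(G)$ has vertex set $G\setminus Z(G)$, and two distinct vertices $x,y$ are adjacent iff $xy\neq yx$. The independent polynomial is $I(\Gamma,x)=\sum_{i=0}^{\alpha(\Gamma)}s_ix^i$, where $s_i$ is the number of independent sets (sets of pairwise non-adjacent vertices, the empty set included) of cardinality $i$ and $\alpha(\Gamma)$ is the independence number. -}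

module Defs where

open import Data.Nat using (ℕ; zero; suc; _+_; _*_; _≤ᵇ_; _%_; NonZero; _≟_)
open import Data.Nat.Combinatorics using (_C_)
open import Data.Bool using (Bool; true; false; if_then_else_)
open import Data.Product using (_×_; _,_)
open import Data.Product.Properties using (≡-dec)
open import Data.List using (List; []; _∷_; map; concatMap; filter; length; upTo; _++_)
open import Data.List.Relation.Unary.All using (All; all?)
open import Data.List.Relation.Unary.AllPairs using (AllPairs; allPairs?)
open import Relation.Binary.PropositionalEquality using (_≡_)
open import Relation.Nullary using (Dec; ¬_; ¬?)
open import Relation.Nullary.Decidable using (_×-dec_)

-- The group U_{6n} = < a, b | a^{2n} = b^3 = 1, a^{-1} b a = b^{-1} >,
-- realised concretely by its normal form: every element is uniquely
-- a^i b^j with 0 ≤ i < 2n, 0 ≤ j < 3; encoded as the pair (i , j).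
-- From b a = a b^{-1} one gets b^j a^k = a^k b^{(-1)^k j}, hence
--   (a^i b^j)(a^k b^l) = a^{i+k} b^{(-1)^k j + l}.

Elt : Set
Elt = ℕ × ℕ

nz2 : (n : ℕ) → .{{NonZero n}} → NonZero (2 * n)
nz2 (suc n) = _

-- (-1)^k j  modulo 3  (note -j ≡ 2j mod 3)
twist : ℕ → ℕ → ℕ
twist k j = if k % 2 ≤ᵇ 0 then j else 2 * j

mul : (n : ℕ) → .{{NonZero n}} → Elt → Elt → Elt
mul n (i , j) (k , l) = (_%_ (i + k) (2 * n) {{nz2 n}} , (twist k j + l) % 3)

elems : (n : ℕ) → List Elt
elems n = concatMap (λ i → map (i ,_) (upTo 3)) (upTo (2 * n))

_≟E_ : (x y : Elt) → Dec (x ≡ y)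
_≟E_ = ≡-dec _≟_ _≟_

Commute : (n : ℕ) → .{{NonZero n}} → Elt → Elt → Set
Commute n x y = mul n x y ≡ mul n y x

commute? : (n : ℕ) → .{{_ : NonZero n}} → (x y : Elt) → Dec (Commute n x y)
commute? n x y = mul n x y ≟E mul n y x

Central : (n : ℕ) → .{{NonZero n}} → Elt → Set
Central n z = All (Commute n z) (elems n)

central? : (n : ℕ) → .{{_ : NonZero n}} → (z : Elt) → Dec (Central n z)
central? n z = all? (commute? n z) (elems n)

-- Non-commuting graph Γ(U_{6n}): vertex set U_{6n} \ Z(U_{6n}),
-- x ~ y iff x y ≠ y x.  (The vertex list has no duplicates.)

vertices : (n : ℕ) → .{{NonZero n}} → List Elt
vertices n = filter (λ z → ¬? (central? n z)) (elems n)

-- all sublists (= all subsets, since the list is duplicate-free)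
subsets : {A : Set} → List A → List (List A)
subsets []       = [] ∷ []
subsets (x ∷ xs) = subsets xs ++ map (x ∷_) (subsets xs)

-- S is independent in Γ: its (distinct) vertices are pairwise
-- non-adjacent, i.e. pairwise commuting
Independent : (n : ℕ) → .{{NonZero n}} → List Elt → Set
Independent n S = AllPairs (Commute n) S

independent? : (n : ℕ) → .{{_ : NonZero n}} → (S : List Elt) → Dec (Independent n S)
independent? n S = allPairs? (commute? n) S

-- s_k : number of independent sets of Γ(U_{6n}) of cardinality k
-- (the empty set included); the k-th coefficient of I(Γ; x).
indepCoeff : (n : ℕ) → .{{NonZero n}} → ℕ → ℕ
indepCoeff n k =
  length (filter (λ S → (length S ≟ k) ×-dec independent? n S) (subsets (vertices n)))

rhsCoeff : ℕ → ℕ → ℕ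
rhsCoeff n zero = 1
rhsCoeff n (suc k) =
  if suc k ≤ᵇ n then (2 * n) C (suc k) + 3 * (n C (suc k))
  else (if suc k ≤ᵇ 2 * n then (2 * n) C (suc k) else 0)

-- Whether two elements commute, and whether an element is
-- central, only depends on its shape (i mod 2 , j). The centre consists of the a^i with i
-- even, and on the remaining vertices commuting means lying in the same of four classes:
-- {a^i b^j : i even, j ≠ 0} of size 2n and {a^i b^r : i odd} for r = 0, 1, 2, each of
-- size n. So Γ is the complete multipartite graph K_{2n,n,n,n}, and a non-empty
-- independent set is a subset of a single class: there are C(2n,k) + 3 C(n,k) of size
-- k ≥ 1, where C(n,k) = 0 for k > n accounts for the two ranges of the formula.

module Submission where

open import Defs
open import Data.Bool using (Bool; true; false; if_then_else_; T)
import Data.Bool.Properties as Bool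
open import Data.Fin using (Fin; zero; suc)
import Data.Fin.Properties as Fin
open import Data.List
  using (List; []; _∷_; _++_; map; concatMap; filter; length; upTo; applyUpTo; cartesianProduct)
open import Data.List.Membership.Propositional using (_∈_)
open import Data.List.Membership.Propositional.Properties
  using (∈-cartesianProduct⁺; ∈-upTo⁺; ∈-concat⁺′; ∈-map⁺)
open import Data.List.Properties
  using (filter-++; length-++; filter-≐; filter-none; filter-accept; filter-reject; map-cong; map-applyUpTo)
open import Data.List.Relation.Unary.All as All using (All; []; _∷_; all?)
open import Data.List.Relation.Unary.All.Properties as All using (all-filter; filter⁺; all-upTo; concat⁺)
open import Data.List.Relation.Unary.AllPairs using (AllPairs; []; _∷_; allPairs?)
open import Data.List.Relation.Unary.Any using (here; there)
open import Data.Nat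
  using (ℕ; zero; suc; z≤n; s≤s; z<s; _+_; _*_; _%_; _≤ᵇ_; _<_; NonZero; >-nonZero⁻¹; _≟_)
open import Data.Nat.Combinatorics using (_C_; nCk+nC[k+1]≡[n+1]C[k+1]; k>n⇒nCk≡0)
open import Data.Nat.DivMod using (_mod_)
open import Data.Nat.ListAction using (sum)
open import Data.Nat.Properties
  using ( +-0-commutativeMonoid; <-trans; +-comm; +-assoc; +-identityʳ; *-suc; *-comm; *-identityʳ
        ; *-monoʳ-≤; suc-injective; ≰⇒>; ≤⇒≤ᵇ)
open import Data.Product using (_×_; _,_; proj₂)
open import Data.Product.Properties using (≡-dec)
open import Data.Unit using (⊤; tt)
open import Function using (_∘_; _⇔_; mk⇔; Equivalence)
open import Function.Construct.Composition using (_⇔-∘_)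
open import Level using (0ℓ)
open import Relation.Binary using (Rel; DecidableEquality)
open import Relation.Binary.PropositionalEquality
open import Relation.Nullary using (Dec; yes; no; ¬_; does; ¬?; contradiction)
open import Relation.Nullary.Decidable using (_×-dec_; _→-dec_; from-yes; map′)
open import Relation.Unary using (Pred; Decidable; _≐_)
open import Relation.Unary.Properties using (_∩?_)

open import Algebra.Properties.CommutativeMonoid.Sum +-0-commutativeMonoid
  using (sum-syntax; ∑-distrib-+; sum-cong-≗; sum-replicate-zero)

open Equivalence using (to; from)
open ≡-Reasoning

¬-cong-⇔ : {A B : Set} → A ⇔ B → (¬ A) ⇔ (¬ B)
¬-cong-⇔ A⇔B = mk⇔ (λ ¬a b → ¬a (from A⇔B b)) (λ ¬b a → ¬b (to A⇔B a))

_⇔-dec_ : {A B : Set} → Dec A → Dec B → Dec (A ⇔ B)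
a? ⇔-dec b? =
  map′ (λ (f , g) → mk⇔ f g) (λ e → to e , from e) ((a? →-dec b?) ×-dec (b? →-dec a?))

module _ {A : Set} {P Q : Pred A 0ℓ} (P? : Decidable P) (Q? : Decidable Q) where

  filter-≐-All : ∀ {xs} → All (λ x → P x ⇔ Q x) xs → filter P? xs ≡ filter Q? xs
  filter-≐-All [] = refl
  filter-≐-All {x ∷ xs} (P⇔Q ∷ rest) with P? x | Q? x
  ... | yes _ | yes _ = cong (x ∷_) (filter-≐-All rest)
  ... | yes p | no ¬q = contradiction (to P⇔Q p) ¬q
  ... | no ¬p | yes q = contradiction (from P⇔Q q) ¬p
  ... | no _  | no _  = filter-≐-All rest

  filter-filter : ∀ xs → filter P? (filter Q? xs) ≡ filter (Q? ∩? P?) xs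
  filter-filter [] = refl
  filter-filter (x ∷ xs) with Q? x
  ... | no _ = filter-filter xs
  ... | yes _ with P? x
  ...   | yes _ = cong (x ∷_) (filter-filter xs)
  ...   | no _  = filter-filter xs

module _ {A : Set} {P : Pred A 0ℓ} (P? : Decidable P) where

  length-filter-++ : ∀ xs ys →
                     length (filter P? (xs ++ ys)) ≡ length (filter P? xs) + length (filter P? ys)
  length-filter-++ xs ys = trans (cong length (filter-++ P? xs ys)) (length-++ (filter P? xs))

  length-filter-map : {B : Set} (f : B → A) (xs : List B) →
                      length (filter P? (map f xs)) ≡ length (filter (P? ∘ f) xs)
  length-filter-map f [] = refl
  length-filter-map f (x ∷ xs) with P? (f x)
  ... | yes _ = cong suc (length-filter-map f xs)
  ... | no _  = length-filter-map f xs

  length-filter-concatMap : {B : Set} (f : B → List A) (xs : List B) →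
                            length (filter P? (concatMap f xs)) ≡ sum (map (length ∘ filter P? ∘ f) xs)
  length-filter-concatMap f [] = refl
  length-filter-concatMap f (x ∷ xs) =
    trans (length-filter-++ (f x) (concatMap f xs))
          (cong (length (filter P? (f x)) +_) (length-filter-concatMap f xs))

module _ {A : Set} {P : Pred (List A) 0ℓ} (P? : Decidable P) where

  length-filter-subsets-∷ : ∀ x xs →
    length (filter P? (subsets (x ∷ xs)))
      ≡ length (filter P? (subsets xs)) + length (filter (P? ∘ (x ∷_)) (subsets xs))
  length-filter-subsets-∷ x xs =
    trans (length-filter-++ P? (subsets xs) (map (x ∷_) (subsets xs)))
          (cong (length (filter P? (subsets xs)) +_) (length-filter-map P? (x ∷_) (subsets xs)))

subsets⁺ : {A : Set} {P : Pred A 0ℓ} {xs : List A} → All P xs → All (All P) (subsets xs)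
subsets⁺ []         = [] ∷ []
subsets⁺ (px ∷ pxs) = All.++⁺ (subsets⁺ pxs) (All.map⁺ (All.map (px ∷_) (subsets⁺ pxs)))

module _ {A : Set} {Q : Pred A 0ℓ} (Q? : Decidable Q) where

  #subsets-All : ∀ xs k →
    length (filter (λ S → (length S ≟ k) ×-dec all? Q? S) (subsets xs)) ≡ length (filter Q? xs) C k
  #subsets-All []       zero    = refl
  #subsets-All []       (suc k) = refl
  #subsets-All (x ∷ xs) k       = trans (length-filter-subsets-∷ _ x xs) (split k (Q? x))
    where
    SubsetOfSize : ℕ → Pred (List A) 0ℓ
    SubsetOfSize k S = length S ≡ k × All Q S

    SubsetOfSize? : ∀ k → Decidable (SubsetOfSize k)
    SubsetOfSize? k S = (length S ≟ k) ×-dec all? Q? S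

    #with-x : ℕ → ℕ
    #with-x k = length (filter (SubsetOfSize? k ∘ (x ∷_)) (subsets xs))

    none-with-x : ∀ {k} → (∀ {S} → ¬ SubsetOfSize k (x ∷ S)) → #with-x k ≡ 0
    none-with-x {k} impossible =
      cong length (filter-none (SubsetOfSize? k ∘ (x ∷_)) (All.universal (λ _ → impossible) (subsets xs)))

    split : ∀ k → Dec (Q x) →
            length (filter (SubsetOfSize? k) (subsets xs)) + #with-x k ≡ length (filter Q? (x ∷ xs)) C k
    split zero _ = cong₂ _+_ (#subsets-All xs zero) (none-with-x (λ { (() , _) }))
    split (suc k) (yes q) = begin
      length (filter (SubsetOfSize? (suc k)) (subsets xs)) + #with-x (suc k)
        ≡⟨ cong₂ _+_ (#subsets-All xs (suc k)) (trans (cong length (filter-≐ _ _ drop-x (subsets xs)))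
                                                     (#subsets-All xs k)) ⟩
      c C suc k + c C k   ≡⟨ +-comm (c C suc k) (c C k) ⟩
      c C k + c C suc k   ≡⟨ nCk+nC[k+1]≡[n+1]C[k+1] c k ⟩
      suc c C suc k       ≡⟨ cong (λ ys → length ys C suc k) (filter-accept Q? q) ⟨
      length (filter Q? (x ∷ xs)) C suc k ∎
      where
      c = length (filter Q? xs)
      drop-x : (SubsetOfSize (suc k) ∘ (x ∷_)) ≐ SubsetOfSize k
      drop-x = (λ { (e , _ ∷ qs) → suc-injective e , qs }) , (λ (e , qs) → cong suc e , q ∷ qs)
    split (suc k) (no ¬q) = begin
      length (filter (SubsetOfSize? (suc k)) (subsets xs)) + #with-x (suc k)
        ≡⟨ cong₂ _+_ (#subsets-All xs (suc k)) (none-with-x (λ { (_ , qx ∷ _) → ¬q qx })) ⟩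
      length (filter Q? xs) C suc k + 0   ≡⟨ +-identityʳ _ ⟩
      length (filter Q? xs) C suc k       ≡⟨ cong (λ ys → length ys C suc k) (filter-reject Q? ¬q) ⟨
      length (filter Q? (x ∷ xs)) C suc k ∎

∑-δ : ∀ {m} (e : Fin m) (f : Fin m → ℕ) → ∑[ d < m ] (if does (e Fin.≟ d) then f d else 0) ≡ f e
∑-δ {suc m} zero    f = trans (cong (f zero +_) (sum-replicate-zero m)) (+-identityʳ (f zero))
∑-δ         (suc e) f = ∑-δ e (f ∘ suc)

module _ {A : Set} {m} (c : A → Fin m) where

  #class : Fin m → List A → ℕ
  #class d V = length (filter (λ x → c x Fin.≟ d) V)

  #class-∷-C : ∀ x xs d k →
    #class d (x ∷ xs) C suc k ≡ #class d xs C suc k + (if does (c x Fin.≟ d) then #class d xs C k else 0)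
  #class-∷-C x xs d k with c x Fin.≟ d
  ... | yes _ = sym (trans (+-comm (#class d xs C suc k) _) (nCk+nC[k+1]≡[n+1]C[k+1] (#class d xs) k))
  ... | no _  = sym (+-identityʳ _)

module Cliques {A : Set} (R : Rel A 0ℓ) (R? : ∀ x y → Dec (R x y)) where

  Clique : ℕ → Pred (List A) 0ℓ
  Clique k S = length S ≡ k × AllPairs R S

  clique? : ∀ k → Decidable (Clique k)
  clique? k S = (length S ≟ k) ×-dec allPairs? R? S

  #cliques : ℕ → List A → ℕ
  #cliques k V = length (filter (clique? k) (subsets V))

  #cliques-zero : ∀ V → #cliques 0 V ≡ 1
  #cliques-zero V =
    trans (cong length (filter-≐ (clique? 0) (λ S → (length S ≟ 0) ×-dec all? (λ _ → yes tt) S)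
                                 only-∅ (subsets V)))
          (#subsets-All (λ _ → yes tt) V 0)
    where
    only-∅ : Clique 0 ≐ (λ S → length S ≡ 0 × All (λ _ → ⊤) S)
    only-∅ = (λ { {[]} _ → refl , [] }) , (λ { {[]} _ → refl , [] })

  module SameClass {m} {G : Pred A 0ℓ} (c : A → Fin m)
                   (classifies : ∀ {x y} → G x → G y → R x y ⇔ (c x ≡ c y)) where

    same-class⇒All : ∀ {x S} → G x → All G S → All (λ y → c y ≡ c x) S → All (R x) S
    same-class⇒All gx gS same = All.zipWith (λ (gy , e) → from (classifies gx gy) (sym e)) (gS , same)

    same-class⇒AllPairs : ∀ {d S} → All G S → All (λ y → c y ≡ d) S → AllPairs R S
    same-class⇒AllPairs []        []       = []
    same-class⇒AllPairs (gx ∷ gS) (e ∷ es) =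
      same-class⇒All gx gS (All.map (λ e′ → trans e′ (sym e)) es) ∷ same-class⇒AllPairs gS es

    clique-∷⇔ : ∀ {x S k} → G x → All G S →
                Clique (suc k) (x ∷ S) ⇔ (length S ≡ k × All (λ y → c y ≡ c x) S)
    clique-∷⇔ gx gS = mk⇔
      (λ { (e , Rx ∷ _) →
             suc-injective e , All.zipWith (λ (gy , r) → sym (to (classifies gx gy) r)) (gS , Rx) })
      (λ (e , same) → cong suc e , same-class⇒All gx gS same ∷ same-class⇒AllPairs gS same)

    #cliques-∷ : ∀ {x xs} → G x → All G xs → ∀ k →
                 #cliques (suc k) (x ∷ xs) ≡ #cliques (suc k) xs + #class c (c x) xs C k
    #cliques-∷ {x} {xs} gx gxs k = begin
      #cliques (suc k) (x ∷ xs)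
        ≡⟨ length-filter-subsets-∷ (clique? (suc k)) x xs ⟩
      #cliques (suc k) xs + length (filter (clique? (suc k) ∘ (x ∷_)) (subsets xs))
        ≡⟨ cong (λ l → #cliques (suc k) xs + length l)
                (filter-≐-All _ _ (All.map (clique-∷⇔ gx) (subsets⁺ gxs))) ⟩
      #cliques (suc k) xs
        + length (filter (λ S → (length S ≟ k) ×-dec all? (λ y → c y Fin.≟ c x) S) (subsets xs))
        ≡⟨ cong (#cliques (suc k) xs +_) (#subsets-All (λ y → c y Fin.≟ c x) xs k) ⟩
      #cliques (suc k) xs + #class c (c x) xs C k ∎

    #cliques-suc : ∀ {V} → All G V → ∀ k → #cliques (suc k) V ≡ ∑[ d < m ] (#class c d V C suc k)
    #cliques-suc [] k = sym (sum-replicate-zero m)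
    #cliques-suc {x ∷ xs} (gx ∷ gxs) k = begin
      #cliques (suc k) (x ∷ xs)
        ≡⟨ #cliques-∷ gx gxs k ⟩
      #cliques (suc k) xs + #class c (c x) xs C k
        ≡⟨ cong₂ _+_ (#cliques-suc gxs k) (sym (∑-δ (c x) (λ d → #class c d xs C k))) ⟩
      ∑[ d < m ] (#class c d xs C suc k) + ∑[ d < m ] (new d)
        ≡⟨ ∑-distrib-+ (λ d → #class c d xs C suc k) new ⟨
      ∑[ d < m ] (#class c d xs C suc k + new d)
        ≡⟨ sum-cong-≗ (λ d → #class-∷-C c x xs d k) ⟨
      ∑[ d < m ] (#class c d (x ∷ xs) C suc k) ∎
      where
      new : Fin m → ℕ
      new d = if does (c x Fin.≟ d) then #class c d xs C k else 0

sum-applyUpTo-periodic : (h : ℕ → ℕ) → (∀ i → h (2 + i) ≡ h i) →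
                         ∀ m → sum (applyUpTo h (2 * m)) ≡ m * (h 0 + h 1)
sum-applyUpTo-periodic h periodic zero    = refl
sum-applyUpTo-periodic h periodic (suc m) = begin
  sum (applyUpTo h (2 * suc m))
    ≡⟨ cong (sum ∘ applyUpTo h) (*-suc 2 m) ⟩
  h 0 + (h 1 + sum (applyUpTo (λ i → h (2 + i)) (2 * m)))
    ≡⟨ cong (λ s → h 0 + (h 1 + s))
            (sum-applyUpTo-periodic (λ i → h (2 + i)) (λ i → periodic (2 + i)) m) ⟩
  h 0 + (h 1 + m * (h 2 + h 3))
    ≡⟨ cong (λ s → h 0 + (h 1 + m * s)) (cong₂ _+_ (periodic 0) (periodic 1)) ⟩
  h 0 + (h 1 + m * (h 0 + h 1))
    ≡⟨ +-assoc (h 0) (h 1) _ ⟨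
  suc m * (h 0 + h 1) ∎

isEven : ℕ → Bool
isEven i = i % 2 ≤ᵇ 0

-- twist k j is definitionally twist′ (isEven k) j.
twist′ : Bool → ℕ → ℕ
twist′ p j = if p then j else 2 * j

Shape : Set
Shape = Bool × ℕ

shape : Elt → Shape
shape (i , j) = isEven i , j

_≟ₛ_ : DecidableEquality Shape
_≟ₛ_ = ≡-dec Bool._≟_ _≟_

ShapesCommute : Shape → Shape → Set
ShapesCommute (p , j) (q , l) = (twist′ q j + l) % 3 ≡ (twist′ p l + j) % 3

shapesCommute? : ∀ s t → Dec (ShapesCommute s t)
shapesCommute? (p , j) (q , l) = (twist′ q j + l) % 3 ≟ (twist′ p l + j) % 3

centralShape : Shape
centralShape = true , 0

centralShape-commutes : ∀ t → ShapesCommute centralShape t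
centralShape-commutes (true  , l) = cong (_% 3) (sym (+-identityʳ l))
centralShape-commutes (false , l) = cong (_% 3) (sym (+-identityʳ l))

classOf : Shape → Fin 4
classOf (p , j) = if p then zero else suc (j mod 3)

shapes : List Shape
shapes = cartesianProduct (true ∷ false ∷ []) (upTo 3)

∈-shapes : ∀ p {j} → j < 3 → (p , j) ∈ shapes
∈-shapes p j<3 = ∈-cartesianProduct⁺ (bool∈ p) (∈-upTo⁺ j<3)
  where
  bool∈ : ∀ p → p ∈ true ∷ false ∷ []
  bool∈ true  = here refl
  bool∈ false = there (here refl)

-- (true , 1) and (false , 0) are the shapes of b and a.
commutes-with-b-a⇒central :
  All (λ s → ShapesCommute s (true , 1) → ShapesCommute s (false , 0) → s ≡ centralShape) shapes
commutes-with-b-a⇒central = from-yes (all? (λ s →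
  shapesCommute? s (true , 1) →-dec shapesCommute? s (false , 0) →-dec s ≟ₛ centralShape) shapes)

classOf-classifies :
  All (λ s → All (λ t → s ≢ centralShape → t ≢ centralShape →
                        ShapesCommute s t ⇔ (classOf s ≡ classOf t)) shapes) shapes
classOf-classifies = from-yes (all? (λ s → all? (λ t →
  ¬? (s ≟ₛ centralShape) →-dec ¬? (t ≟ₛ centralShape) →-dec
  (shapesCommute? s t ⇔-dec (classOf s Fin.≟ classOf t))) shapes) shapes)

vertexShape? : Decidable (_≢ centralShape)
vertexShape? s = ¬? (s ≟ₛ centralShape)

inClass? : ∀ d → Decidable (λ s → classOf s ≡ d)
inClass? d s = classOf s Fin.≟ d

vertexShape-inClass? : ∀ d → Decidable (λ s → s ≢ centralShape × classOf s ≡ d)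
vertexShape-inClass? d = vertexShape? ∩? inClass? d

row-count : Fin 4 → Bool → ℕ
row-count d p = length (filter (vertexShape-inClass? d ∘ (p ,_)) (upTo 3))

elems-normal : ∀ n → All (λ x → proj₂ x < 3) (elems n)
elems-normal n =
  concat⁺ (All.map⁺ (All.universal (λ i → All.map⁺ {f = i ,_} (all-upTo 3)) (upTo (2 * n))))

∈-elems : ∀ n {i j} → i < 2 * n → j < 3 → (i , j) ∈ elems n
∈-elems n {i} i<2n j<3 =
  ∈-concat⁺′ (∈-map⁺ (i ,_) (∈-upTo⁺ j<3))
             (∈-map⁺ (λ i → map (i ,_) (upTo 3)) (∈-upTo⁺ i<2n))

module _ (n : ℕ) .{{_ : NonZero n}} where

  commute⇔ : ∀ x y → Commute n x y ⇔ ShapesCommute (shape x) (shape y)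
  commute⇔ (i , j) (k , l) =
    mk⇔ (cong proj₂) (cong₂ _,_ (cong (λ s → _%_ s (2 * n) {{nz2 n}}) (+-comm i k)))

  centralShape⇒central : ∀ x → shape x ≡ centralShape → Central n x
  centralShape⇒central x e = All.universal commutes (elems n)
    where
    commutes : ∀ y → Commute n x y
    commutes y = from (commute⇔ x y)
      (subst (λ s → ShapesCommute s (shape y)) (sym e) (centralShape-commutes (shape y)))

  central⇔ : ∀ x → proj₂ x < 3 → Central n x ⇔ (shape x ≡ centralShape)
  central⇔ x@(i , _) j<3 = mk⇔ central⇒ (centralShape⇒central x)
    where
    1<2n : 1 < 2 * n
    1<2n = *-monoʳ-≤ 2 (>-nonZero⁻¹ n)
    central⇒ : Central n x → shape x ≡ centralShape
    central⇒ x∈Z = All.lookup commutes-with-b-a⇒central (∈-shapes (isEven i) j<3)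
      (to (commute⇔ x (0 , 1)) (All.lookup x∈Z (∈-elems n (<-trans z<s 1<2n) (s≤s (s≤s z≤n)))))
      (to (commute⇔ x (1 , 0)) (All.lookup x∈Z (∈-elems n 1<2n z<s)))

  IsVertex : Elt → Set
  IsVertex x = proj₂ x < 3 × ¬ Central n x

  vertices-IsVertex : All IsVertex (vertices n)
  vertices-IsVertex = All.zip (filter⁺ _ (elems-normal n) , all-filter _ (elems n))

  commute⇔sameClass : ∀ {x y} → IsVertex x → IsVertex y →
                      Commute n x y ⇔ (classOf (shape x) ≡ classOf (shape y))
  commute⇔sameClass {x@(i , _)} {y@(k , _)} (j<3 , x∉Z) (l<3 , y∉Z) = classify ⇔-∘ commute⇔ x y
    where
    classify : ShapesCommute (shape x) (shape y) ⇔ (classOf (shape x) ≡ classOf (shape y))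
    classify = All.lookup (All.lookup classOf-classifies (∈-shapes (isEven i) j<3)) (∈-shapes (isEven k) l<3)
      (x∉Z ∘ centralShape⇒central x) (y∉Z ∘ centralShape⇒central y)

  vertices-by-shape : vertices n ≡ filter (vertexShape? ∘ shape) (elems n)
  vertices-by-shape = filter-≐-All _ _ (All.map (λ {x} j<3 → ¬-cong-⇔ (central⇔ x j<3)) (elems-normal n))

  classSize : Fin 4 → ℕ
  classSize zero    = 2 * n
  classSize (suc _) = n

  #class-vertices : ∀ d → #class (classOf ∘ shape) d (vertices n) ≡ classSize d
  #class-vertices d = begin
    #class (classOf ∘ shape) d (vertices n)
      ≡⟨ cong (#class (classOf ∘ shape) d) vertices-by-shape ⟩
    length (filter (inClass? d ∘ shape) (filter (vertexShape? ∘ shape) (elems n)))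
      ≡⟨ cong length (filter-filter (inClass? d ∘ shape) (vertexShape? ∘ shape) (elems n)) ⟩
    length (filter (P? ∘ shape) (elems n))
      ≡⟨ length-filter-concatMap (P? ∘ shape) (λ i → map (i ,_) (upTo 3)) (upTo (2 * n)) ⟩
    sum (map (λ i → length (filter (P? ∘ shape) (map (i ,_) (upTo 3)))) (upTo (2 * n)))
      ≡⟨ cong sum (map-cong (λ i → length-filter-map (P? ∘ shape) (i ,_) (upTo 3)) (upTo (2 * n))) ⟩
    sum (map (row-count d ∘ isEven) (upTo (2 * n)))
      ≡⟨ cong sum (map-applyUpTo (λ i → i) (row-count d ∘ isEven) (2 * n)) ⟩
    sum (applyUpTo (row-count d ∘ isEven) (2 * n))
      ≡⟨ sum-applyUpTo-periodic (row-count d ∘ isEven) (λ _ → refl) n ⟩   -- (2 + i) % 2 reduces to i % 2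
    n * (row-count d true + row-count d false)
      ≡⟨ even-and-odd-row d ⟩
    classSize d ∎
    where
    P? = vertexShape-inClass? d
    even-and-odd-row : ∀ d → n * (row-count d true + row-count d false) ≡ classSize d
    even-and-odd-row zero                   = *-comm n 2
    even-and-odd-row (suc zero)             = *-identityʳ n
    even-and-odd-row (suc (suc zero))       = *-identityʳ n
    even-and-odd-row (suc (suc (suc zero))) = *-identityʳ n

k≰ᵇn⇒nCk≡0 : ∀ n k → (k ≤ᵇ n) ≡ false → n C k ≡ 0
k≰ᵇn⇒nCk≡0 n k k≰n = k>n⇒nCk≡0 {n} {k} (≰⇒> (λ k≤n → subst T k≰n (≤⇒≤ᵇ k≤n)))

rhsCoeff-suc : ∀ n k → rhsCoeff n (suc k) ≡ (2 * n) C suc k + 3 * (n C suc k)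
rhsCoeff-suc n k = by-cases (suc k ≤ᵇ n) refl (suc k ≤ᵇ 2 * n) refl
  where
  by-cases : ∀ b₁ → (suc k ≤ᵇ n) ≡ b₁ → ∀ b₂ → (suc k ≤ᵇ 2 * n) ≡ b₂ →
             (if b₁ then (2 * n) C suc k + 3 * (n C suc k) else (if b₂ then (2 * n) C suc k else 0))
             ≡ (2 * n) C suc k + 3 * (n C suc k)
  by-cases true  _   _     _    = refl
  by-cases false k≰n true  _    rewrite k≰ᵇn⇒nCk≡0 n (suc k) k≰n = sym (+-identityʳ _)
  by-cases false k≰n false k≰2n
    rewrite k≰ᵇn⇒nCk≡0 n (suc k) k≰n | k≰ᵇn⇒nCk≡0 (2 * n) (suc k) k≰2n = refl

theorem4p6 : (n : ℕ) → .{{_ : NonZero n}} → (k : ℕ) → indepCoeff n k ≡ rhsCoeff n k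
theorem4p6 n zero    = Cliques.#cliques-zero (Commute n) (commute? n) (vertices n)
theorem4p6 n (suc k) = begin
  indepCoeff n (suc k)
    ≡⟨ #cliques-suc (vertices-IsVertex n) k ⟩
  ∑[ d < 4 ] (#class (classOf ∘ shape) d (vertices n) C suc k)
    ≡⟨ sum-cong-≗ (λ d → cong (_C suc k) (#class-vertices n d)) ⟩
  (2 * n) C suc k + 3 * (n C suc k)
    ≡⟨ rhsCoeff-suc n k ⟨
  rhsCoeff n (suc k) ∎
  where
  open Cliques.SameClass (Commute n) (commute? n) {G = IsVertex n} (classOf ∘ shape)
                         (λ {x} {y} → commute⇔sameClass n {x} {y})
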